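{- Let $\mathcal{R}$ be a deterministic oriented 3-CTRS (DCTRS) over a signature $\mathcal{F}$. Then $\mathcal{R}$ is quasi-decreasing if and only if the context-sensitive rewrite system $U_{\mathsf{CS}}(\mathcal{R})$ is $\mu$-terminating on original terms.
   Context: A DCTRS $\mathcal{R}$ over $\mathcal{F}$ is a set of conditional rules $\ell\to r\Leftarrow s_1\approx t_1,\dots,s_n\approx t_n$ ($n\ge 0$) with terms in $\mathcal{T}(\mathcal{F},\mathcal{V})$ such that $\ell\notin\mathcal{V}$, $\mathcal{V}ar(r)\subseteq\mathcal{V}ar(\ell,s_1,t_1,\dots,s_n,t_n)$, and $\mathcal{V}ar(s_i)\subseteq\mathcal{V}ar(\ell,t_1,\dots,t_{i-1})$ for all $1\le i\le n$. Its rewrite relation is $\to_{\mathcal{R}}=\bigcup_{i\ge0}\to_{\mathcal{R}_i}$ where $\mathcal{R}_0=\varnothing$ and $\mathcal{R}_{i+1}=\{\ell\sigma\to r\sigma \mid (\ell\to r\Leftarrow c)\in\mathcal{R},\ \forall (s\approx t)\in c.\ s\sigma\to_{\mathcal{R}_i}^* t\sigma\}$ (with $\to_{\mathcal{S}}$ the ordinary rewrite relation of a TRS $\mathcal{S}$). Rules with $n=0$ form $\mathcal{R}_{\mathsf{u}}$, rules with $n>0$ form $\mathcal{R}_{\mathsf{c}}$. $\mathcal{R}$ is quasi-decreasing if there is a well-founded order $\succ$ on $\mathcal{T}(\mathcal{F},\mathcal{V})$ such that (i) $\succ=(\succ\cup\vartriangleright)^+$ where $\vartriangleright$ is the proper subterm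 relation, (ii) $\to_{\mathcal{R}}\subseteq\succ$, and (iii) for every rule $\ell\to r\Leftarrow s_1\approx t_1,\dots,s_n\approx t_n$ in $\mathcal{R}$, every substitution $\sigma\colon\mathcal{V}\to\mathcal{T}(\mathcal{F},\mathcal{V})$ and every $0\le i<n$: if $s_j\sigma\to_{\mathcal{R}}^* t_j\sigma$ for all $1\le j\le i$, then $\ell\sigma\succ s_{i+1}\sigma$. Unraveling $U(\mathcal{R})$: for each conditional rule $\rho\colon \ell\to r\Leftarrow s_1\approx t_1,\dots,s_n\approx t_n$ with $n>0$, introduce fresh function symbols $U^\rho_1,\dots,U^\rho_n$ and the $n+1$ unconditional rules $\ell\to U^\rho_1(s_1,\vec{X}(\ell))$, $U^\rho_i(t_i,\vec{X}(\ell),\vec{E}(t_1,\dots,t_{i-1}))\to U^\rho_{i+1}(s_{i+1},\vec{X}(\ell),\vec{E}(t_1,\dots,t_i))$ for $1\le i<n$, and $U^\rho_n(t_n,\vec{X}(\ell),\vec{E}(t_1,\dots,t_{n-1}))\to r$. Here $\vec{X}(\ell)$ is the sequence of variables of $\ell$ and $\vec{E}(t_1,\dots,t_i)$ the sequence of the extra variables $\mathcal{EV}(t_1)\cup\dots\cup\mathcal{EV}(t_i)$, where $\mathcal{EV}(t_k)=\mathcal{V}ar(t_k)\setminus\mathcal{V}ar(\ell,t_1,\dots,t_{k-1})$, each in some arbitrary but fixed order. Then $U(\mathcal{R})=\mathcal{R}_{\mathsf{u}}\cup\bigcup_{\rho\in\mathcal{R}_{\mathsf{c}}}U(\rho)$.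 The context-sensitive unraveling $U_{\mathsf{CS}}(\mathcal{R})$ is the TRS $U(\mathcal{R})$ together with the replacement map $\mu$ with $\mu(f)=\{1,\dots,k\}$ for $f\in\mathcal{F}$ of arity $k$ and $\mu(f)=\{1\}$ for the new $U$-symbols; its rewrite relation $\to_\mu$ permits rewriting only at active positions (a position $p$ is active in $t$ if $p=\epsilon$, or $p=iq$, $t=f(t_1,\dots,t_n)$, $i\in\mu(f)$ and $q$ active in $t_i$). $U_{\mathsf{CS}}(\mathcal{R})$ is $\mu$-terminating on original terms if there is no infinite $\to_\mu$-reduction starting from a term in $\mathcal{T}(\mathcal{F},\mathcal{V})$. -}

module Defs where

open import Data.Nat using (ℕ; zero; suc; _+_)
import Data.Nat.Properties as ℕₚ
open import Data.Fin using (Fin; toℕ)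
open import Data.Vec as Vec using (Vec; []; _∷_; lookup; _[_]≔_)
open import Data.List as List using (List; []; _∷_; _++_; length; take; deduplicate; filter; concatMap)
open import Data.List.Membership.Propositional using (_∈_)
open import Data.List.Membership.DecPropositional ℕₚ._≟_ using (_∉?_)
open import Data.List.Relation.Unary.All using (All)
open import Data.Product using (Σ; _×_; _,_; proj₁; proj₂; ∃)
open import Data.Sum using (_⊎_; inj₁; inj₂)
open import Data.Empty using (⊥)
open import Data.Unit using (⊤)
open import Relation.Nullary using (¬_)
open import Relation.Binary.PropositionalEquality using (_≡_)
open import Relation.Binary.Construct.Closure.ReflexiveTransitive using (Star)
open import Relation.Binary.Construct.Closure.Transitive using (TransClosure)
open import Induction.WellFounded using (WellFounded; Acc)

record Sig : Set₁ where
  constructor sig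
  field
    Sym : Set
    ar  : Sym → ℕ
open Sig public

data Term (F : Sig) : Set where
  var : ℕ → Term F
  fun : (f : Sym F) → Vec (Term F) (ar F f) → Term F

Subst : Sig → Set
Subst F = ℕ → Term F

mutual
  _⟨_⟩ : ∀ {F} → Term F → Subst F → Term F
  var x    ⟨ σ ⟩ = σ x
  fun f ts ⟨ σ ⟩ = fun f (ts ⟨ σ ⟩*)

  _⟨_⟩* : ∀ {F n} → Vec (Term F) n → Subst F → Vec (Term F) n
  []       ⟨ σ ⟩* = []
  (t ∷ ts) ⟨ σ ⟩* = (t ⟨ σ ⟩) ∷ (ts ⟨ σ ⟩*)

mutual
  vars : ∀ {F} → Term F → List ℕ
  vars (var x)    = x ∷ []
  vars (fun f ts) = vars* ts

  vars* : ∀ {F n} → Vec (Term F) n → List ℕ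
  vars* []       = []
  vars* (t ∷ ts) = vars t ++ vars* ts

data _▷_ {F : Sig} : Term F → Term F → Set where
  imm  : ∀ {f ts} (k : Fin (ar F f)) → fun f ts ▷ lookup ts k
  deep : ∀ {f ts t} (k : Fin (ar F f)) → lookup ts k ▷ t → fun f ts ▷ t

-- Rewriting w.r.t. a (possibly infinite) set of rules given as a
-- relation Rl, restricted to argument positions allowed by `allowed`
-- (a replacement map; the full map gives ordinary rewriting).

data Step {F : Sig} (allowed : (f : Sym F) → Fin (ar F f) → Set)
          (Rl : Term F → Term F → Set) : Term F → Term F → Set where
  root : ∀ {l r} (σ : Subst F) → Rl l r → Step allowed Rl (l ⟨ σ ⟩) (r ⟨ σ ⟩)
  arg  : ∀ {f} {ts : Vec (Term F) (ar F f)} {u} (k : Fin (ar F f)) →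
         allowed f k → Step allowed Rl (lookup ts k) u →
         Step allowed Rl (fun f ts) (fun f (ts [ k ]≔ u))

fullμ : (F : Sig) → (f : Sym F) → Fin (ar F f) → Set
fullμ F f k = ⊤

_⟶[_] : ∀ {F} → Term F → (Term F → Term F → Set) → Term F → Set
(s ⟶[ Rl ]) t = Step (fullμ _) Rl s t

record CRule (F : Sig) : Set where
  constructor _⇒_⇐_
  field
    lhs   : Term F
    rhs   : Term F
    conds : List (Term F × Term F)
open CRule public

record CTRS (F : Sig) : Set₁ where
  constructor ctrs
  field
    Idx  : Set
    rule : Idx → CRule F
open CTRS public

IsVar : ∀ {F} → Term F → Set
IsVar t = ∃ λ x → t ≡ var x

varsCond : ∀ {F} → List (Term F × Term F) → List ℕ
varsCond = concatMap (λ c → vars (proj₁ c) ++ vars (proj₂ c))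

varsRhsSides : ∀ {F} → List (Term F × Term F) → List ℕ
varsRhsSides = concatMap (λ c → vars (proj₂ c))

_⊆ᵥ_ : List ℕ → List ℕ → Set
xs ⊆ᵥ ys = ∀ {x} → x ∈ xs → x ∈ ys

IsDCTRS : ∀ {F} → CTRS F → Set
IsDCTRS {F} R = ∀ (ρ : Idx R) →
  let ℓ = lhs (rule R ρ) ; r = rhs (rule R ρ) ; c = conds (rule R ρ) in
  (¬ IsVar ℓ)
  × (vars r ⊆ᵥ (vars ℓ ++ varsCond c))
  × (∀ (pre post : List (Term F × Term F)) (s t : Term F) →
       c ≡ pre ++ (s , t) ∷ post →
       vars s ⊆ᵥ (vars ℓ ++ varsRhsSides pre))

mutual
  Rᵢ : ∀ {F} → CTRS F → ℕ → Term F → Term F → Set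
  Rᵢ R zero    l r = ⊥
  Rᵢ {F} R (suc i) l r = Σ (Idx R) λ ρ → Σ (Subst F) λ σ →
      (l ≡ lhs (rule R ρ) ⟨ σ ⟩) × (r ≡ rhs (rule R ρ) ⟨ σ ⟩)
      × All (λ c → Star (λ a b → (a ⟶[ Rᵢ R i ]) b) (proj₁ c ⟨ σ ⟩) (proj₂ c ⟨ σ ⟩))
            (conds (rule R ρ))

_⟶⟨_⟩_ : ∀ {F} → Term F → CTRS F → Term F → Set
s ⟶⟨ R ⟩ t = ∃ λ i → (s ⟶[ Rᵢ R i ]) t

_⟶⟨_⟩*_ : ∀ {F} → Term F → CTRS F → Term F → Set
s ⟶⟨ R ⟩* t = Star (λ a b → a ⟶⟨ R ⟩ b) s t

-- Quasi-decreasingness.  "≻ well-founded" = every term is accessible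
-- w.r.t. the converse of ≻ (no infinite ≻-descending chains).

QuasiDecreasing : ∀ {F} → CTRS F → Set₁
QuasiDecreasing {F} R = Σ (Term F → Term F → Set) λ _≻_ →
    WellFounded (λ a b → b ≻ a)
  × (∀ {a b c} → a ≻ b → b ≻ c → a ≻ c)
  × (∀ a b → a ≻ b → TransClosure (λ x y → x ≻ y ⊎ x ▷ y) a b)
  × (∀ a b → TransClosure (λ x y → x ≻ y ⊎ x ▷ y) a b → a ≻ b)
  × (∀ a b → a ⟶⟨ R ⟩ b → a ≻ b)
  × (∀ (ρ : Idx R) (σ : Subst F) (pre post : List (Term F × Term F)) (s t : Term F) →
       conds (rule R ρ) ≡ pre ++ (s , t) ∷ post →
       All (λ c → (proj₁ c ⟨ σ ⟩) ⟶⟨ R ⟩* (proj₂ c ⟨ σ ⟩)) pre →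
       (lhs (rule R ρ) ⟨ σ ⟩) ≻ (s ⟨ σ ⟩))

Xs : ∀ {F} (R : CTRS F) → Idx R → List ℕ
Xs R ρ = deduplicate ℕₚ._≟_ (vars (lhs (rule R ρ)))

-- E(t₁,…,t_k) = EV(t₁) ∪ … ∪ EV(t_k) = Var(t₁,…,t_k) ∖ Var(ℓ),
-- in order of first occurrence
Es : ∀ {F} (R : CTRS F) → Idx R → ℕ → List ℕ
Es R ρ k = deduplicate ℕₚ._≟_
  (filter (_∉? vars (lhs (rule R ρ))) (varsRhsSides (take k (conds (rule R ρ)))))

-- U-symbol index: (ρ , j) stands for U^ρ_{j+1}
USym : ∀ {F} → CTRS F → Set
USym R = Σ (Idx R) λ ρ → Fin (length (conds (rule R ρ)))

USig : ∀ {F} → CTRS F → Sig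
USig {F} R = sig (Sym F ⊎ USym R) arity
  where
  arity : Sym F ⊎ USym R → ℕ
  arity (inj₁ f)       = ar F f
  arity (inj₂ (ρ , j)) = suc (length (Xs R ρ) + length (Es R ρ (toℕ j)))

mutual
  emb : ∀ {F} (R : CTRS F) → Term F → Term (USig R)
  emb R (var x)    = var x
  emb R (fun f ts) = fun (inj₁ f) (emb* R ts)

  emb* : ∀ {F n} (R : CTRS F) → Vec (Term F) n → Vec (Term (USig R)) n
  emb* R []       = []
  emb* R (t ∷ ts) = emb R t ∷ emb* R ts

varVec : ∀ {G : Sig} (xs : List ℕ) → Vec (Term G) (length xs)
varVec xs = Vec.map var (Vec.fromList xs)

Uterm : ∀ {F} (R : CTRS F) (ρ : Idx R) (j : Fin (length (conds (rule R ρ)))) →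
        Term (USig R) → Term (USig R)
Uterm R ρ j u = fun (inj₂ (ρ , j)) (u ∷ (varVec (Xs R ρ) Vec.++ varVec (Es R ρ (toℕ j))))

condS condT : ∀ {F} (R : CTRS F) (ρ : Idx R) → Fin (length (conds (rule R ρ))) → Term F
condS R ρ j = proj₁ (List.lookup (conds (rule R ρ)) j)
condT R ρ j = proj₂ (List.lookup (conds (rule R ρ)) j)

data URule {F : Sig} (R : CTRS F) : Term (USig R) → Term (USig R) → Set where
  uncond : ∀ ρ → conds (rule R ρ) ≡ [] →
           URule R (emb R (lhs (rule R ρ))) (emb R (rhs (rule R ρ)))
  first  : ∀ ρ (j : Fin (length (conds (rule R ρ)))) → toℕ j ≡ 0 →
           URule R (emb R (lhs (rule R ρ))) (Uterm R ρ j (emb R (condS R ρ j)))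
  middle : ∀ ρ (j j′ : Fin (length (conds (rule R ρ)))) → toℕ j′ ≡ suc (toℕ j) →
           URule R (Uterm R ρ j (emb R (condT R ρ j))) (Uterm R ρ j′ (emb R (condS R ρ j′)))
  last   : ∀ ρ (j : Fin (length (conds (rule R ρ)))) → suc (toℕ j) ≡ length (conds (rule R ρ)) →
           URule R (Uterm R ρ j (emb R (condT R ρ j))) (emb R (rhs (rule R ρ)))

μU : ∀ {F} (R : CTRS F) → (f : Sym (USig R)) → Fin (ar (USig R) f) → Set
μU R (inj₁ f) k = ⊤
μU R (inj₂ u) k = toℕ k ≡ 0

UCSStep : ∀ {F} (R : CTRS F) → Term (USig R) → Term (USig R) → Set
UCSStep R = Step (μU R) (URule R)

UCS-μTerminatingOnOriginal : ∀ {F} → CTRS F → Set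
UCS-μTerminatingOnOriginal {F} R =
  ∀ (t : Term F) → Acc (λ a b → UCSStep R b a) (emb R t)

-- (⇐) Let a ≻ b hold when emb a reaches emb b by μ-steps and passages to
-- active subterms.  This order is well founded because U_CS(R) is μ-terminating
-- and a μ-step inside an active subterm is a μ-step of the whole term; it
-- contains →_R because U_CS(R) simulates every conditional step; and ℓσ ≻ s_iσ
-- once s_1σ →* t_1σ, …, s_{i-1}σ →* t_{i-1}σ hold, since then
-- ℓσ →μ⁺ U^ρ_i(s_iσ, …).
--
-- (⇒) Every term reachable from an original term can be read back as an
-- original term, a U^ρ_i-subterm standing for the redex ℓθ it came from; a
-- μ-step either leaves the reading unchanged or performs an R-step on it.
-- Termination then follows by well-founded induction on ≻, inside which a
-- U^ρ_i-subterm terminates by induction on the number of conditions left and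
-- on its first argument, the latter being terminating because ℓθ ≻ s_iθ.

module Submission where

open import Defs
open import Data.Nat as ℕ using (ℕ; zero; suc; _+_; _∸_; _<_; _≤_; _⊔_)
import Data.Nat.Properties as ℕₚ
open import Data.Fin as Fin using (Fin; toℕ; fromℕ<)
import Data.Fin.Properties as Finₚ
open import Data.Vec as Vec using (Vec; []; _∷_; lookup; _[_]≔_)
import Data.Vec.Properties as Vecₚ
open import Data.List as List using (List; []; _∷_; _++_; take; drop; length; _∷ʳ_)
import Data.List.Properties as Listₚ
open import Data.List.Membership.Propositional using (_∈_; find; lose)
import Data.List.Membership.Propositional.Properties as ∈ₚ
open import Data.List.Membership.DecPropositional ℕₚ._≟_ using (_∈?_; _∉?_)
open import Data.List.Relation.Unary.Any using (here; there)
open import Data.List.Relation.Unary.All as All using (All; []; _∷_)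
import Data.List.Relation.Unary.All.Properties as Allₚ
open import Data.Product using (Σ; _×_; _,_; proj₁; proj₂; ∃)
open import Data.Sum using (_⊎_; inj₁; inj₂)
import Data.Sum.Properties as Sumₚ
open import Data.Unit using (tt)
open import Data.Empty using (⊥-elim)
open import Function using (id; flip; _∘_)
open import Function.Bundles using (_⇔_; mk⇔)
open import Relation.Nullary using (¬_; yes; no)
open import Relation.Binary.PropositionalEquality
open import Relation.Binary.Construct.Closure.ReflexiveTransitive as Star using (Star; ε; _◅_; _◅◅_)
open import Relation.Binary.Construct.Closure.Transitive as Plus using (TransClosure; [_]; _∷_)
import Relation.Binary.Construct.On as On
open import Induction.WellFounded using (WellFounded; Acc; acc)
import Induction.WellFounded as WF

private
  variable
    F G : Sig

⁺-gmap : ∀ {A B : Set} {S : A → A → Set} {T : B → B → Set} (f : A → B) →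
         (∀ {x y} → S x y → T (f x) (f y)) → ∀ {x y} → TransClosure S x y → TransClosure T (f x) (f y)
⁺-gmap f g [ s ]   = [ g s ]
⁺-gmap f g (s ∷ p) = g s ∷ ⁺-gmap f g p

⁺-map : ∀ {A : Set} {S T : A → A → Set} → (∀ {x y} → S x y → T x y) →
        ∀ {x y} → TransClosure S x y → TransClosure T x y
⁺-map = ⁺-gmap id

⁺⇒* : ∀ {A : Set} {S : A → A → Set} {x y} → TransClosure S x y → Star S x y
⁺⇒* [ s ]   = s ◅ ε
⁺⇒* (s ∷ p) = s ◅ ⁺⇒* p

_⁺◅◅_ : ∀ {A : Set} {S : A → A → Set} {x y z} → TransClosure S x y → Star S y z → TransClosure S x z
p ⁺◅◅ ε       = p
p ⁺◅◅ (s ◅ q) = (p Plus.∷ʳ s) ⁺◅◅ q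

⁺-reverse : ∀ {A : Set} {S : A → A → Set} {x y} → TransClosure S x y → TransClosure (flip S) y x
⁺-reverse [ s ]   = [ s ]
⁺-reverse (s ∷ p) = ⁺-reverse p Plus.∷ʳ s

mutual
  ⟨⟩-cong : ∀ (t : Term F) {σ τ : Subst F} → (∀ {x} → x ∈ vars t → σ x ≡ τ x) → t ⟨ σ ⟩ ≡ t ⟨ τ ⟩
  ⟨⟩-cong (var x)    h = h (here refl)
  ⟨⟩-cong (fun f ts) h = cong (fun f) (⟨⟩*-cong ts h)

  ⟨⟩*-cong : ∀ {n} (ts : Vec (Term F) n) {σ τ : Subst F} →
             (∀ {x} → x ∈ vars* ts → σ x ≡ τ x) → ts ⟨ σ ⟩* ≡ ts ⟨ τ ⟩*
  ⟨⟩*-cong []       h = refl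
  ⟨⟩*-cong (t ∷ ts) h = cong₂ _∷_ (⟨⟩-cong t (h ∘ ∈ₚ.∈-++⁺ˡ)) (⟨⟩*-cong ts (h ∘ ∈ₚ.∈-++⁺ʳ (vars t)))

mutual
  ⟨⟩-∘ : ∀ (t : Term F) (σ τ : Subst F) → t ⟨ σ ⟩ ⟨ τ ⟩ ≡ t ⟨ (λ x → σ x ⟨ τ ⟩) ⟩
  ⟨⟩-∘ (var x)    σ τ = refl
  ⟨⟩-∘ (fun f ts) σ τ = cong (fun f) (⟨⟩*-∘ ts σ τ)

  ⟨⟩*-∘ : ∀ {n} (ts : Vec (Term F) n) (σ τ : Subst F) → ts ⟨ σ ⟩* ⟨ τ ⟩* ≡ ts ⟨ (λ x → σ x ⟨ τ ⟩) ⟩*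
  ⟨⟩*-∘ []       σ τ = refl
  ⟨⟩*-∘ (t ∷ ts) σ τ = cong₂ _∷_ (⟨⟩-∘ t σ τ) (⟨⟩*-∘ ts σ τ)

mutual
  ⟨var⟩ : ∀ (t : Term F) → t ⟨ var ⟩ ≡ t
  ⟨var⟩ (var x)    = refl
  ⟨var⟩ (fun f ts) = cong (fun f) (⟨var⟩* ts)

  ⟨var⟩* : ∀ {n} (ts : Vec (Term F) n) → ts ⟨ var ⟩* ≡ ts
  ⟨var⟩* []       = refl
  ⟨var⟩* (t ∷ ts) = cong₂ _∷_ (⟨var⟩ t) (⟨var⟩* ts)

lookup-⟨⟩* : ∀ {n} (ts : Vec (Term F) n) k (σ : Subst F) → lookup (ts ⟨ σ ⟩*) k ≡ lookup ts k ⟨ σ ⟩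
lookup-⟨⟩* (t ∷ ts) Fin.zero    σ = refl
lookup-⟨⟩* (t ∷ ts) (Fin.suc k) σ = lookup-⟨⟩* ts k σ

[]≔-⟨⟩* : ∀ {n} (ts : Vec (Term F) n) k u (σ : Subst F) → (ts [ k ]≔ u) ⟨ σ ⟩* ≡ (ts ⟨ σ ⟩*) [ k ]≔ (u ⟨ σ ⟩)
[]≔-⟨⟩* (t ∷ ts) Fin.zero    u σ = refl
[]≔-⟨⟩* (t ∷ ts) (Fin.suc k) u σ = cong (_ ∷_) ([]≔-⟨⟩* ts k u σ)

++-⟨⟩* : ∀ {m n} (as : Vec (Term F) m) (bs : Vec (Term F) n) (σ : Subst F) →
         (as Vec.++ bs) ⟨ σ ⟩* ≡ (as ⟨ σ ⟩*) Vec.++ (bs ⟨ σ ⟩*)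
++-⟨⟩* []       bs σ = refl
++-⟨⟩* (a ∷ as) bs σ = cong (_ ∷_) (++-⟨⟩* as bs σ)

varVec-⟨⟩*-injective : ∀ (xs : List ℕ) {σ τ : Subst G} → varVec {G} xs ⟨ σ ⟩* ≡ varVec xs ⟨ τ ⟩* →
                       ∀ {x} → x ∈ xs → σ x ≡ τ x
varVec-⟨⟩*-injective (y ∷ xs) e (here refl) = Vecₚ.∷-injectiveˡ e
varVec-⟨⟩*-injective (y ∷ xs) e (there x∈) = varVec-⟨⟩*-injective xs (Vecₚ.∷-injectiveʳ e) x∈

fun-injectiveˡ : ∀ {G : Sig} {f f′ : Sym G} {us us′} → fun {G} f us ≡ fun f′ us′ → f ≡ f′
fun-injectiveˡ refl = refl

fun-injectiveʳ : ∀ {G : Sig} {f : Sym G} {us us′} → fun {G} f us ≡ fun f us′ → us ≡ us′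
fun-injectiveʳ refl = refl

ReplacementMap : Sig → Set₁
ReplacementMap G = (f : Sym G) → Fin (ar G f) → Set

module _ {al : ReplacementMap G} {Rl : Term G → Term G → Set} where

  Step-⟨⟩ : ∀ {a b} (σ : Subst G) → Step al Rl a b → Step al Rl (a ⟨ σ ⟩) (b ⟨ σ ⟩)
  Step-⟨⟩ σ (root {l} {r} τ l→r) =
    subst₂ (Step al Rl) (sym (⟨⟩-∘ l τ σ)) (sym (⟨⟩-∘ r τ σ)) (root _ l→r)
  Step-⟨⟩ σ (arg {f} {ts} {u} k k∈ st) =
    subst (λ vs → Step al Rl (fun f (ts ⟨ σ ⟩*)) (fun f vs)) (sym ([]≔-⟨⟩* ts k u σ))
      (arg k k∈ (subst (λ v → Step al Rl v (u ⟨ σ ⟩)) (sym (lookup-⟨⟩* ts k σ)) (Step-⟨⟩ σ st)))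

  Step-[]≔ : ∀ {f} (ts : Vec (Term G) (ar G f)) k {u v} → al f k → Step al Rl u v →
             Step al Rl (fun f (ts [ k ]≔ u)) (fun f (ts [ k ]≔ v))
  Step-[]≔ {f} ts k {u} {v} k∈ st =
    subst (λ vs → Step al Rl (fun f (ts [ k ]≔ u)) (fun f vs)) (Vecₚ.[]≔-idempotent ts k)
      (arg k k∈ (subst (λ w → Step al Rl w v) (sym (Vecₚ.lookup∘update k ts u)) st))

  Star-arg : ∀ {f} (ts : Vec (Term G) (ar G f)) k {u} → al f k →
             Star (Step al Rl) (lookup ts k) u → Star (Step al Rl) (fun f ts) (fun f (ts [ k ]≔ u))
  Star-arg {f} ts k {u} k∈ ss =
    subst (λ vs → Star (Step al Rl) (fun f vs) (fun f (ts [ k ]≔ u))) (Vecₚ.[]≔-lookup ts k)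
      (Star.gmap (λ w → fun f (ts [ k ]≔ w)) (Step-[]≔ ts k k∈) ss)

  Plus-arg : ∀ {f} (ts : Vec (Term G) (ar G f)) k {u} → al f k →
             TransClosure (Step al Rl) (lookup ts k) u → TransClosure (Step al Rl) (fun f ts) (fun f (ts [ k ]≔ u))
  Plus-arg {f} ts k {u} k∈ ss =
    subst (λ vs → TransClosure (Step al Rl) (fun f vs) (fun f (ts [ k ]≔ u))) (Vecₚ.[]≔-lookup ts k)
      (⁺-gmap (λ w → fun f (ts [ k ]≔ w)) (Step-[]≔ ts k k∈) ss)

Step-map : ∀ {al : ReplacementMap G} {Rl Rl′ : Term G → Term G → Set} →
           (∀ {l r} → Rl l r → Rl′ l r) → ∀ {a b} → Step al Rl a b → Step al Rl′ a b
Step-map f (root σ l→r)  = root σ (f l→r)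
Step-map f (arg k k∈ st) = arg k k∈ (Step-map f st)

data ActiveSubterm (al : ReplacementMap G) : Term G → Term G → Set where
  active : ∀ {f ts} k → al f k → ActiveSubterm al (fun f ts) (lookup ts k)

module _ {al : ReplacementMap G} where

  mutual
    ActiveSubterm-wellFounded : WellFounded (flip (ActiveSubterm al))
    ActiveSubterm-wellFounded (var x)    = acc λ ()
    ActiveSubterm-wellFounded (fun f ts) = acc λ { (active k _) → acc-lookup ts k }

    acc-lookup : ∀ {n} (ts : Vec (Term G) n) k → Acc (flip (ActiveSubterm al)) (lookup ts k)
    acc-lookup (t ∷ ts) Fin.zero    = ActiveSubterm-wellFounded t
    acc-lookup (t ∷ ts) (Fin.suc k) = acc-lookup ts k

module _ {al : ReplacementMap G} {Rl : Term G → Term G → Set} where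

  private
    _⟶_ = Step al Rl
    _⊳_ = ActiveSubterm al

  Step-lift-active : ∀ {x y y′} → Star _⊳_ x y → y ⟶ y′ → ∃ λ x′ → x ⟶ x′ × Star _⊳_ x′ y′
  Step-lift-active ε st = _ , st , ε
  Step-lift-active (active {ts = ts} k k∈ ◅ ⊳*) st with Step-lift-active ⊳* st
  ... | v , st′ , ⊳*′ =
    fun _ (ts [ k ]≔ v) , arg k k∈ st′ ,
    subst (ActiveSubterm al _) (Vecₚ.lookup∘update k ts v) (active k k∈) ◅ ⊳*′

  acc-Step⊎ActiveSubterm : ∀ {x} → Acc (flip _⟶_) x → Acc (flip (λ a b → a ⟶ b ⊎ a ⊳ b)) x
  acc-Step⊎ActiveSubterm ax = go ax ε (ActiveSubterm-wellFounded _)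
    where
    go : ∀ {x} → Acc (flip _⟶_) x → ∀ {y} → Star _⊳_ x y → Acc (flip _⊳_) y →
         Acc (flip (λ a b → a ⟶ b ⊎ a ⊳ b)) y
    go ax x⊳*y ay = acc (down ax x⊳*y ay)
      where
      down : ∀ {x} → Acc (flip _⟶_) x → ∀ {y} → Star _⊳_ x y → Acc (flip _⊳_) y →
             ∀ {z} → y ⟶ z ⊎ y ⊳ z → Acc (flip (λ a b → a ⟶ b ⊎ a ⊳ b)) z
      down (acc hx) x⊳*y _ (inj₁ st) with Step-lift-active x⊳*y st
      ... | x′ , st′ , x′⊳*y′ = go (hx st′) x′⊳*y′ (ActiveSubterm-wellFounded _)
      down ax x⊳*y (acc hy) (inj₂ y⊳) = go ax (x⊳*y ◅◅ y⊳ ◅ ε) (hy y⊳)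

module _ {A : Set} (S : A → A → Set) where

  UpdateAt : ∀ {n} → Vec A n → Vec A n → Set
  UpdateAt us vs = ∃ λ k → ∃ λ w → S (lookup us k) w × vs ≡ us [ k ]≔ w

  UpdateAt-acc : ∀ {n} (us : Vec A n) → (∀ k → Acc (flip S) (lookup us k)) → Acc (flip UpdateAt) us
  UpdateAt-acc []       _   = acc λ { (() , _) }
  UpdateAt-acc (u ∷ us) acc-us = go (acc-us Fin.zero) (UpdateAt-acc us (acc-us ∘ Fin.suc))
    where
    go : ∀ {u : A} {n} {us : Vec A n} → Acc (flip S) u → Acc (flip UpdateAt) us → Acc (flip UpdateAt) (u ∷ us)
    go (acc rec-u) acc-us@(acc rec-us) = acc λ
      { (Fin.zero  , w , st , refl) → go (rec-u st) acc-us
      ; (Fin.suc k , w , st , refl) → go (acc rec-u) (rec-us (k , w , st , refl)) }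

Satisfies : (R : CTRS F) → Subst F → List (Term F × Term F) → Set
Satisfies R θ = All (λ c → (proj₁ c ⟨ θ ⟩) ⟶⟨ R ⟩* (proj₂ c ⟨ θ ⟩))

module _ (R : CTRS F) where

  Rᵢ-mono : ∀ {i j} → i ≤ j → ∀ {l r} → Rᵢ R i l r → Rᵢ R j l r
  Rᵢ-mono {suc i} {suc j} (ℕ.s≤s i≤j) (ρ , σ , l≡ , r≡ , cs) =
    ρ , σ , l≡ , r≡ , All.map (Star.map (Step-map (Rᵢ-mono i≤j))) cs

  private
    lift : ∀ {i j} → i ≤ j → ∀ {a b} → Star (_⟶[ Rᵢ R i ]) a b → Star (_⟶[ Rᵢ R j ]) a b
    lift i≤j = Star.map (Step-map (Rᵢ-mono i≤j))

  ⟶*-level : ∀ {a b} → a ⟶⟨ R ⟩* b → ∃ λ i → Star (_⟶[ Rᵢ R i ]) a b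
  ⟶*-level ε = 0 , ε
  ⟶*-level ((i , st) ◅ ss) with ⟶*-level ss
  ... | j , ss′ = i ⊔ j , Step-map (Rᵢ-mono (ℕₚ.m≤m⊔n i j)) st ◅ lift (ℕₚ.m≤n⊔m i j) ss′

  Satisfies-level : ∀ {θ} (cs : List (Term F × Term F)) → Satisfies R θ cs →
    ∃ λ i → All (λ c → Star (_⟶[ Rᵢ R i ]) (proj₁ c ⟨ θ ⟩) (proj₂ c ⟨ θ ⟩)) cs
  Satisfies-level []       []       = 0 , []
  Satisfies-level (c ∷ cs) (h ∷ hs) with ⟶*-level h | Satisfies-level cs hs
  ... | i , h′ | j , hs′ = i ⊔ j , lift (ℕₚ.m≤m⊔n i j) h′ ∷ All.map (lift (ℕₚ.m≤n⊔m i j)) hs′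

  rule-⟶ : ∀ ρ (θ : Subst F) → Satisfies R θ (conds (rule R ρ)) →
           (lhs (rule R ρ) ⟨ θ ⟩) ⟶⟨ R ⟩ (rhs (rule R ρ) ⟨ θ ⟩)
  rule-⟶ ρ θ hs with Satisfies-level _ hs
  ... | i , hs′ = suc i , subst₂ _⟶[ Rᵢ R (suc i) ] (⟨var⟩ _) (⟨var⟩ _) (root var (ρ , θ , refl , refl , hs′))

Satisfies-cong : ∀ (R : CTRS F) (cs : List (Term F × Term F)) {θ θ′ : Subst F} →
  (∀ {x} → x ∈ varsCond cs → θ x ≡ θ′ x) → Satisfies R θ cs → Satisfies R θ′ cs
Satisfies-cong R []            θ≗θ′ []       = []
Satisfies-cong R ((s , t) ∷ cs) θ≗θ′ (h ∷ hs) =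
  subst₂ (λ a b → a ⟶⟨ R ⟩* b) (⟨⟩-cong s (θ≗θ′ ∘ ∈ₚ.∈-++⁺ˡ ∘ ∈ₚ.∈-++⁺ˡ))
                                (⟨⟩-cong t (θ≗θ′ ∘ ∈ₚ.∈-++⁺ˡ ∘ ∈ₚ.∈-++⁺ʳ (vars s))) h
  ∷ Satisfies-cong R cs (θ≗θ′ ∘ ∈ₚ.∈-++⁺ʳ (vars s ++ vars t)) hs

index-of-middle : ∀ {A : Set} (xs pre post : List A) c → xs ≡ pre ++ c ∷ post →
  ∃ λ (j : Fin (length xs)) → toℕ j ≡ length pre × List.lookup xs j ≡ c × take (length pre) xs ≡ pre
index-of-middle _ []        post c refl = Fin.zero , refl , refl , refl
index-of-middle _ (p ∷ pre) post c refl with index-of-middle _ pre post c refl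
... | j , j≡ , xsⱼ≡ , take≡ = Fin.suc j , cong suc j≡ , xsⱼ≡ , cong (p ∷_) take≡

split-at-index : ∀ {A : Set} (xs : List A) (j : Fin (length xs)) →
  xs ≡ take (toℕ j) xs ++ List.lookup xs j ∷ drop (suc (toℕ j)) xs
split-at-index (x ∷ xs) Fin.zero    = refl
split-at-index (x ∷ xs) (Fin.suc j) = cong (x ∷_) (split-at-index xs j)

Deterministic : List ℕ → List (Term F × Term F) → Set
Deterministic {F} V cs = ∀ (pre post : List (Term F × Term F)) s t → cs ≡ pre ++ (s , t) ∷ post →
  vars s ⊆ᵥ (V ++ varsRhsSides pre)

++⁺ʳ-⊆ : ∀ (V : List ℕ) {A B : List ℕ} → A ⊆ᵥ B → (V ++ A) ⊆ᵥ (V ++ B)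
++⁺ʳ-⊆ V A⊆B x∈ with ∈ₚ.∈-++⁻ V x∈
... | inj₁ x∈V = ∈ₚ.∈-++⁺ˡ x∈V
... | inj₂ x∈A = ∈ₚ.∈-++⁺ʳ V (A⊆B x∈A)

varsRhsSides-++⁺ˡ : ∀ (as bs : List (Term F × Term F)) → varsRhsSides as ⊆ᵥ varsRhsSides (as ++ bs)
varsRhsSides-++⁺ˡ as bs x∈ = subst (_ ∈_) (sym (Listₚ.concatMap-++ _ as bs)) (∈ₚ.∈-++⁺ˡ x∈)

varsCond-deterministic : ∀ V (cs : List (Term F × Term F)) → Deterministic V cs →
  varsCond cs ⊆ᵥ (V ++ varsRhsSides cs)
varsCond-deterministic V cs det x∈ with find (∈ₚ.∈-concatMap⁻ (λ c → vars (proj₁ c) ++ vars (proj₂ c)) {xs = cs} x∈)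
... | (s , t) , c∈ , x∈c with ∈ₚ.∈-∃++ c∈ | ∈ₚ.∈-++⁻ (vars s) x∈c
... | pre , post , cs≡ | inj₁ x∈s =
  ++⁺ʳ-⊆ V (subst (λ as → varsRhsSides pre ⊆ᵥ varsRhsSides as) (sym cs≡) (varsRhsSides-++⁺ˡ pre _))
    (det pre post s t cs≡ x∈s)
... | _ | inj₂ x∈t = ∈ₚ.∈-++⁺ʳ V (∈ₚ.∈-concatMap⁺ _ (lose c∈ x∈t))

Deterministic-take : ∀ V (cs : List (Term F × Term F)) m → Deterministic V cs → Deterministic V (take m cs)
Deterministic-take V cs m det pre post s t take≡ = det pre (post ++ drop m cs) s t
  (trans (sym (Listₚ.take++drop≡id m cs)) (trans (cong (_++ drop m cs) take≡) (Listₚ.++-assoc pre _ (drop m cs))))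

module _ (R : CTRS F) where

  mutual
    emb-⟨⟩ : ∀ (t : Term F) (σ : Subst F) → emb R (t ⟨ σ ⟩) ≡ emb R t ⟨ emb R ∘ σ ⟩
    emb-⟨⟩ (var x)    σ = refl
    emb-⟨⟩ (fun f ts) σ = cong (fun (inj₁ f)) (emb*-⟨⟩ ts σ)

    emb*-⟨⟩ : ∀ {n} (ts : Vec (Term F) n) (σ : Subst F) → emb* R (ts ⟨ σ ⟩*) ≡ emb* R ts ⟨ emb R ∘ σ ⟩*
    emb*-⟨⟩ []       σ = refl
    emb*-⟨⟩ (t ∷ ts) σ = cong₂ _∷_ (emb-⟨⟩ t σ) (emb*-⟨⟩ ts σ)

  emb*-lookup : ∀ {n} (ts : Vec (Term F) n) k → lookup (emb* R ts) k ≡ emb R (lookup ts k)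
  emb*-lookup (t ∷ ts) Fin.zero    = refl
  emb*-lookup (t ∷ ts) (Fin.suc k) = emb*-lookup ts k

  emb*-[]≔ : ∀ {n} (ts : Vec (Term F) n) k u → emb* R (ts [ k ]≔ u) ≡ emb* R ts [ k ]≔ emb R u
  emb*-[]≔ (t ∷ ts) Fin.zero    u = refl
  emb*-[]≔ (t ∷ ts) (Fin.suc k) u = cong (_ ∷_) (emb*-[]≔ ts k u)

  emb-nonvar : ∀ (s : Term F) → ¬ IsVar s → ∀ {σ x} → emb R s ⟨ σ ⟩ ≢ var x
  emb-nonvar (var y)    s≢var _ = s≢var (y , refl)
  emb-nonvar (fun f ss) _     ()

  emb-nonvar-root : ∀ (s : Term F) → ¬ IsVar s → ∀ {σ f us} → emb R s ⟨ σ ⟩ ≡ fun f us → ∃ λ g → f ≡ inj₁ g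
  emb-nonvar-root (var x)    s≢var _    = ⊥-elim (s≢var (x , refl))
  emb-nonvar-root (fun g ss) _     refl = g , refl

module Simulation (R : CTRS F) where

  private
    infix 4 _⟶μ_ _⟶μ⁺_ _⟶μ*_
    _⟶μ_ = UCSStep R
    _⟶μ⁺_ = TransClosure _⟶μ_
    _⟶μ*_ = Star _⟶μ_

    cs : Idx R → List (Term F × Term F)
    cs ρ = conds (rule R ρ)

  HoldsU : Subst F → Term F × Term F → Set
  HoldsU θ c = emb R (proj₁ c ⟨ θ ⟩) ⟶μ* emb R (proj₂ c ⟨ θ ⟩)

  U-evaluates-condition : ∀ ρ θ j → HoldsU θ (List.lookup (cs ρ) j) →
    Uterm R ρ j (emb R (condS R ρ j)) ⟨ emb R ∘ θ ⟩ ⟶μ* Uterm R ρ j (emb R (condT R ρ j)) ⟨ emb R ∘ θ ⟩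
  U-evaluates-condition ρ θ j h =
    subst₂ (λ a b → fun (inj₂ (ρ , j)) (a ∷ args) ⟶μ* fun (inj₂ (ρ , j)) (b ∷ args))
      (emb-⟨⟩ R (condS R ρ j) θ) (emb-⟨⟩ R (condT R ρ j) θ)
      (Star-arg {f = inj₂ (ρ , j)} (_ ∷ args) Fin.zero refl h)
    where args = (varVec (Xs R ρ) Vec.++ varVec (Es R ρ (toℕ j))) ⟨ emb R ∘ θ ⟩*

  U-reaches-condition : ∀ ρ θ m (j : Fin (length (cs ρ))) → toℕ j ≡ m → All (HoldsU θ) (take m (cs ρ)) →
    emb R (lhs (rule R ρ)) ⟨ emb R ∘ θ ⟩ ⟶μ⁺ Uterm R ρ j (emb R (condS R ρ j)) ⟨ emb R ∘ θ ⟩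
  U-reaches-condition ρ θ zero    j j≡0 _  = [ root _ (first ρ j j≡0) ]
  U-reaches-condition ρ θ (suc m) j j≡ hs =
    U-reaches-condition ρ θ m i i≡m hs-before
      ⁺◅◅ (U-evaluates-condition ρ θ i hᵢ ◅◅ root _ (middle ρ i j (trans j≡ (cong suc (sym i≡m)))) ◅ ε)
    where
    m<len : m < length (cs ρ)
    m<len = ℕₚ.<-trans (ℕₚ.n<1+n m) (subst (_< length (cs ρ)) j≡ (Finₚ.toℕ<n j))
    i = fromℕ< m<len
    i≡m = Finₚ.toℕ-fromℕ< m<len
    take-snoc : take (suc m) (cs ρ) ≡ take m (cs ρ) ∷ʳ List.lookup (cs ρ) i
    take-snoc = trans (cong (λ n → take (suc n) (cs ρ)) (sym i≡m))
                      (trans (Listₚ.take-suc (cs ρ) i) (cong (λ n → take n (cs ρ) ∷ʳ List.lookup (cs ρ) i) i≡m))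
    hs-before×hᵢ = Allₚ.∷ʳ⁻ (subst (All (HoldsU θ)) take-snoc hs)
    hs-before = proj₁ hs-before×hᵢ
    hᵢ = proj₂ hs-before×hᵢ

  U-simulates-rule : ∀ ρ θ → All (HoldsU θ) (cs ρ) →
    emb R (lhs (rule R ρ) ⟨ θ ⟩) ⟶μ⁺ emb R (rhs (rule R ρ) ⟨ θ ⟩)
  U-simulates-rule ρ θ hs =
    subst₂ _⟶μ⁺_ (sym (emb-⟨⟩ R (lhs (rule R ρ)) θ)) (sym (emb-⟨⟩ R (rhs (rule R ρ)) θ)) (go (cs ρ) refl)
    where
    go : ∀ xs → cs ρ ≡ xs →
         emb R (lhs (rule R ρ)) ⟨ emb R ∘ θ ⟩ ⟶μ⁺ emb R (rhs (rule R ρ)) ⟨ emb R ∘ θ ⟩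
    go []       cs≡ = [ root _ (uncond ρ cs≡) ]
    go (_ ∷ xs) cs≡ =
      U-reaches-condition ρ θ n j j≡n (Allₚ.take⁺ n hs)
        ⁺◅◅ (U-evaluates-condition ρ θ j (All.lookup hs (∈ₚ.∈-lookup j)) ◅◅ root _ (last ρ j j-last) ◅ ε)
      where
      n = length xs
      n<len : n < length (cs ρ)
      n<len = subst (n <_) (sym (cong length cs≡)) (ℕₚ.n<1+n n)
      j = fromℕ< n<len
      j≡n = Finₚ.toℕ-fromℕ< n<len
      j-last : suc (toℕ j) ≡ length (cs ρ)
      j-last = trans (cong suc j≡n) (sym (cong length cs≡))

  mutual
    U-simulates-⟶ᵢ : ∀ i {a b} → (a ⟶[ Rᵢ R i ]) b → emb R a ⟶μ⁺ emb R b
    U-simulates-⟶ᵢ (suc i) (root σ (ρ , θ , refl , refl , hs)) =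
      subst₂ _⟶μ⁺_ (sym (emb-⟨⟩ R (lhs (rule R ρ) ⟨ θ ⟩) σ)) (sym (emb-⟨⟩ R (rhs (rule R ρ) ⟨ θ ⟩) σ))
        (⁺-gmap (_⟨ emb R ∘ σ ⟩) (Step-⟨⟩ _) (U-simulates-rule ρ θ (U-simulates-conds i hs)))
    U-simulates-⟶ᵢ i (arg {f} {ts} {u} k _ st) =
      subst (λ vs → fun (inj₁ f) (emb* R ts) ⟶μ⁺ fun (inj₁ f) vs) (sym (emb*-[]≔ R ts k u))
        (Plus-arg (emb* R ts) k tt (subst (_⟶μ⁺ emb R u) (sym (emb*-lookup R ts k)) (U-simulates-⟶ᵢ i st)))

    U-simulates-conds : ∀ i {θ} {xs : List (Term F × Term F)} →
      All (λ c → Star (_⟶[ Rᵢ R i ]) (proj₁ c ⟨ θ ⟩) (proj₂ c ⟨ θ ⟩)) xs → All (HoldsU θ) xs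
    U-simulates-conds i []       = []
    U-simulates-conds i (h ∷ hs) = U-simulates-⟶ᵢ* i h ∷ U-simulates-conds i hs

    U-simulates-⟶ᵢ* : ∀ i {a b} → Star (_⟶[ Rᵢ R i ]) a b → emb R a ⟶μ* emb R b
    U-simulates-⟶ᵢ* i ε        = ε
    U-simulates-⟶ᵢ* i (st ◅ ss) = ⁺⇒* (U-simulates-⟶ᵢ i st) ◅◅ U-simulates-⟶ᵢ* i ss

  U-simulates-⟶* : ∀ {a b} → a ⟶⟨ R ⟩* b → emb R a ⟶μ* emb R b
  U-simulates-⟶* ε               = ε
  U-simulates-⟶* ((i , st) ◅ ss) = ⁺⇒* (U-simulates-⟶ᵢ i st) ◅◅ U-simulates-⟶* ss

module μTerminating⇒QuasiDecreasing (R : CTRS F) (terminating : UCS-μTerminatingOnOriginal R) where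

  open Simulation R

  private
    infix 4 _⟶μ⊎⊳_
    _⟶μ⊎⊳_ : Term (USig R) → Term (USig R) → Set
    a ⟶μ⊎⊳ b = UCSStep R a b ⊎ ActiveSubterm (μU R) a b

  infix 4 _≻_
  _≻_ : Term F → Term F → Set
  a ≻ b = TransClosure _⟶μ⊎⊳_ (emb R a) (emb R b)

  ≻-wellFounded : WellFounded (flip _≻_)
  ≻-wellFounded a =
    On.accessible (emb R)
      (WF.Subrelation.accessible ⁺-reverse
        (Plus.accessible (flip _⟶μ⊎⊳_) (acc-Step⊎ActiveSubterm (terminating a))))

  ▷⇒≻ : ∀ {a b} → a ▷ b → a ≻ b
  ▷⇒≻ (imm k)    = [ inj₂ (emb-active k) ]
    where
    emb-active : ∀ {f ts} k → ActiveSubterm (μU R) (emb R (fun f ts)) (emb R (lookup ts k))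
    emb-active {ts = ts} k = subst (ActiveSubterm (μU R) _) (emb*-lookup R ts k) (active k tt)
  ▷⇒≻ (deep k p) = ▷⇒≻ (imm k) Plus.++ ▷⇒≻ p

  ≻⊎▷⇒≻ : ∀ {a b} → a ≻ b ⊎ a ▷ b → a ≻ b
  ≻⊎▷⇒≻ (inj₁ a≻b) = a≻b
  ≻⊎▷⇒≻ (inj₂ a▷b) = ▷⇒≻ a▷b

  ≻⊎▷⁺⇒≻ : ∀ {a b} → TransClosure (λ x y → x ≻ y ⊎ x ▷ y) a b → a ≻ b
  ≻⊎▷⁺⇒≻ = Plus.transitive⁻ _≻_ Plus._++_ ∘ ⁺-map ≻⊎▷⇒≻

  ⟶⇒≻ : ∀ {a b} → a ⟶⟨ R ⟩ b → a ≻ b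
  ⟶⇒≻ (i , st) = ⁺-map inj₁ (U-simulates-⟶ᵢ i st)

  ≻-condition : ∀ ρ (σ : Subst F) pre post s t → conds (rule R ρ) ≡ pre ++ (s , t) ∷ post →
    Satisfies R σ pre → lhs (rule R ρ) ⟨ σ ⟩ ≻ s ⟨ σ ⟩
  ≻-condition ρ σ pre post s t cs≡ hs with index-of-middle _ pre post (s , t) cs≡
  ... | j , j≡ , csⱼ≡ , take≡ =
    subst₂ (TransClosure _⟶μ⊎⊳_) (sym (emb-⟨⟩ R (lhs (rule R ρ)) σ)) sⱼ≡
      (⁺-map inj₁ (U-reaches-condition ρ σ (length pre) j j≡ (subst (All (HoldsU σ)) (sym take≡) (All.map U-simulates-⟶* hs)))
        Plus.∷ʳ inj₂ (active Fin.zero refl))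
    where
    sⱼ≡ : emb R (condS R ρ j) ⟨ emb R ∘ σ ⟩ ≡ emb R (s ⟨ σ ⟩)
    sⱼ≡ = trans (sym (emb-⟨⟩ R (condS R ρ j) σ)) (cong (λ c → emb R (proj₁ c ⟨ σ ⟩)) csⱼ≡)

  quasiDecreasing : QuasiDecreasing R
  quasiDecreasing =
    _≻_ , ≻-wellFounded , Plus._++_ , (λ _ _ p → [ inj₁ p ]) , (λ _ _ → ≻⊎▷⁺⇒≻) , (λ _ _ → ⟶⇒≻) , ≻-condition

-- The variables passed on by U^ρ_{m+1}: X(ℓ) followed by E(t₁, …, t_m).
UVars : (R : CTRS F) → Idx R → ℕ → List ℕ
UVars R ρ m = Xs R ρ ++ Es R ρ m

module RuleVariables (R : CTRS F) (dctrs : IsDCTRS R) (ρ : Idx R) where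

  private
    ℓ  = lhs (rule R ρ)
    cs = conds (rule R ρ)

  ∈-UVars⁺ : ∀ m → (vars ℓ ++ varsRhsSides (take m cs)) ⊆ᵥ UVars R ρ m
  ∈-UVars⁺ m {x} x∈ with x ∈? vars ℓ | ∈ₚ.∈-++⁻ (vars ℓ) x∈
  ... | yes x∈ℓ | _         = ∈ₚ.∈-++⁺ˡ (∈ₚ.∈-deduplicate⁺ ℕₚ._≟_ x∈ℓ)
  ... | no  x∉ℓ | inj₁ x∈ℓ  = ⊥-elim (x∉ℓ x∈ℓ)
  ... | no  x∉ℓ | inj₂ x∈RS =
    ∈ₚ.∈-++⁺ʳ (Xs R ρ) (∈ₚ.∈-deduplicate⁺ ℕₚ._≟_ (∈ₚ.∈-filter⁺ (_∉? vars ℓ) x∈RS x∉ℓ))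

  ∈-UVars⁻ : ∀ m → UVars R ρ m ⊆ᵥ (vars ℓ ++ varsRhsSides (take m cs))
  ∈-UVars⁻ m x∈ with ∈ₚ.∈-++⁻ (Xs R ρ) x∈
  ... | inj₁ x∈X = ∈ₚ.∈-++⁺ˡ (∈ₚ.∈-deduplicate⁻ ℕₚ._≟_ (vars ℓ) x∈X)
  ... | inj₂ x∈E = ∈ₚ.∈-++⁺ʳ (vars ℓ) (proj₁ (∈ₚ.∈-filter⁻ (_∉? vars ℓ) (∈ₚ.∈-deduplicate⁻ ℕₚ._≟_ _ x∈E)))

  vars-lhs⊆UVars : ∀ m → vars ℓ ⊆ᵥ UVars R ρ m
  vars-lhs⊆UVars m = ∈-UVars⁺ m ∘ ∈ₚ.∈-++⁺ˡ

  UVars-zero : UVars R ρ 0 ⊆ᵥ vars ℓ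
  UVars-zero x∈ with ∈ₚ.∈-++⁻ (vars ℓ) (∈-UVars⁻ 0 x∈)
  ... | inj₁ x∈ℓ = x∈ℓ

  UVars-suc : ∀ j {x} → x ∈ UVars R ρ (suc (toℕ j)) → x ∈ UVars R ρ (toℕ j) ⊎ x ∈ vars (condT R ρ j)
  UVars-suc j x∈ with ∈ₚ.∈-++⁻ (vars ℓ) (∈-UVars⁻ (suc (toℕ j)) x∈)
  ... | inj₁ x∈ℓ  = inj₁ (vars-lhs⊆UVars (toℕ j) x∈ℓ)
  ... | inj₂ x∈RS
    with ∈ₚ.∈-++⁻ (varsRhsSides (take (toℕ j) cs))
           (subst (_ ∈_) (trans (cong varsRhsSides (Listₚ.take-suc cs j)) (Listₚ.concatMap-++ (vars ∘ proj₂) (take (toℕ j) cs) _)) x∈RS)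
  ... | inj₁ x∈RSⱼ = inj₁ (∈-UVars⁺ (toℕ j) (∈ₚ.∈-++⁺ʳ (vars ℓ) x∈RSⱼ))
  ... | inj₂ x∈tⱼ  = inj₂ (subst (_ ∈_) (Listₚ.++-identityʳ _) x∈tⱼ)

  private
    deterministic : Deterministic (vars ℓ) cs
    deterministic = proj₂ (proj₂ (dctrs ρ))

  vars-condS⊆UVars : ∀ j → vars (condS R ρ j) ⊆ᵥ UVars R ρ (toℕ j)
  vars-condS⊆UVars j = ∈-UVars⁺ (toℕ j) ∘ deterministic _ _ _ _ (split-at-index cs j)

  varsCond-take⊆UVars : ∀ m → varsCond (take m cs) ⊆ᵥ UVars R ρ m
  varsCond-take⊆UVars m =
    ∈-UVars⁺ m ∘ varsCond-deterministic (vars ℓ) (take m cs) (Deterministic-take (vars ℓ) cs m deterministic)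

  vars-rhs⊆UVars : vars (rhs (rule R ρ)) ⊆ᵥ UVars R ρ (length cs)
  vars-rhs⊆UVars x∈ =
    ∈-UVars⁺ (length cs) (subst (λ as → _ ∈ vars ℓ ++ varsRhsSides as) (sym (Listₚ.take-all _ cs ℕₚ.≤-refl))
      (absorb (++⁺ʳ-⊆ (vars ℓ) (varsCond-deterministic (vars ℓ) cs deterministic) (proj₁ (proj₂ (dctrs ρ)) x∈))))
    where
    absorb : (vars ℓ ++ (vars ℓ ++ varsRhsSides cs)) ⊆ᵥ (vars ℓ ++ varsRhsSides cs)
    absorb x∈ with ∈ₚ.∈-++⁻ (vars ℓ) x∈
    ... | inj₁ x∈ℓ = ∈ₚ.∈-++⁺ˡ x∈ℓ
    ... | inj₂ x∈′ = x∈′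

module BackTranslation (R : CTRS F) where

  private
    TermU = Term (USig R)

    ℓ : Idx R → Term F
    ℓ ρ = lhs (rule R ρ)

    cs : Idx R → List (Term F × Term F)
    cs ρ = conds (rule R ρ)

  UApp : ∀ ρ (j : Fin (length (cs ρ))) → TermU → Subst (USig R) → TermU
  UApp ρ j v σ = fun (inj₂ (ρ , j)) (v ∷ (varVec (Xs R ρ) Vec.++ varVec (Es R ρ (toℕ j))) ⟨ σ ⟩*)

  -- u ↦ t: the U_CS(R)-term u stands for the original term t.  A subterm
  -- U^ρ_{j+1}(v, σ(X), σ(E)) stands for a redex ℓθ of ρ whose first j
  -- conditions hold under θ, where v stands for a reduct of s_{j+1}θ.
  infix 4 _↦_ _↦*_
  mutual
    data _↦_ : TermU → Term F → Set where
      var↦ : ∀ x → var x ↦ var x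
      fun↦ : ∀ f {us ts} → us ↦* ts → fun (inj₁ f) us ↦ fun f ts
      U↦   : ∀ {u t} ρ j {v σ} → u ≡ UApp ρ j v σ → UState ρ j v σ t → u ↦ t

    data _↦*_ : ∀ {n} → Vec TermU n → Vec (Term F) n → Set where
      []  : [] ↦* []
      _∷_ : ∀ {n u t} {us : Vec TermU n} {ts} → u ↦ t → us ↦* ts → u ∷ us ↦* t ∷ ts

    record Matched ρ (m : ℕ) (σ : Subst (USig R)) (t : Term F) : Set where
      inductive
      no-eta-equality
      pattern
      constructor matched
      field
        θ         : Subst F
        t≡        : t ≡ ℓ ρ ⟨ θ ⟩
        vars↦     : ∀ {x} → x ∈ UVars R ρ m → σ x ↦ θ x
        satisfied : Satisfies R θ (take m (cs ρ))

    record UState ρ (j : Fin (length (cs ρ))) (v : TermU) (σ : Subst (USig R)) (t : Term F) : Set where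
      inductive
      no-eta-equality
      pattern
      constructor ustate
      field
        frame     : Matched ρ (toℕ j) σ t
        t′        : Term F
        evaluated : (condS R ρ j ⟨ Matched.θ frame ⟩) ⟶⟨ R ⟩* t′
        v↦        : v ↦ t′

  castMatched : ∀ {ρ m n σ t} → m ≡ n → Matched ρ m σ t → Matched ρ n σ t
  castMatched refl fr = fr

  ↦*-lookup : ∀ {n} {us : Vec TermU n} {ts} → us ↦* ts → ∀ k → lookup us k ↦ lookup ts k
  ↦*-lookup (r ∷ rs) Fin.zero    = r
  ↦*-lookup (r ∷ rs) (Fin.suc k) = ↦*-lookup rs k

  ↦*-[]≔ : ∀ {n} {us : Vec TermU n} {ts} → us ↦* ts → ∀ k {u t} → u ↦ t → us [ k ]≔ u ↦* ts [ k ]≔ t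
  ↦*-[]≔ (r ∷ rs) Fin.zero    r′ = r′ ∷ rs
  ↦*-[]≔ (r ∷ rs) (Fin.suc k) r′ = r ∷ ↦*-[]≔ rs k r′

  UApp-injective : ∀ {ρ ρ′ j j′ v v′ σ σ′} → UApp ρ j v σ ≡ UApp ρ′ j′ v′ σ′ →
    Σ (ρ ≡ ρ′) λ { refl → Σ (j ≡ j′) λ { refl →
      v ≡ v′ × (∀ {x} → x ∈ UVars R ρ (toℕ j) → σ x ≡ σ′ x) } }
  UApp-injective {ρ} {j = j} {σ = σ} {σ′} e with Sumₚ.inj₂-injective (fun-injectiveˡ {G = USig R} e)
  ... | refl = refl , refl , Vecₚ.∷-injectiveˡ args≡ , agree
    where
    args≡ = fun-injectiveʳ {G = USig R} e
    X = varVec {USig R} (Xs R ρ)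
    E = varVec {USig R} (Es R ρ (toℕ j))
    X⟨⟩++E⟨⟩≡ : (X ⟨ σ ⟩*) Vec.++ (E ⟨ σ ⟩*) ≡ (X ⟨ σ′ ⟩*) Vec.++ (E ⟨ σ′ ⟩*)
    X⟨⟩++E⟨⟩≡ = trans (sym (++-⟨⟩* X E σ)) (trans (Vecₚ.∷-injectiveʳ args≡) (++-⟨⟩* X E σ′))
    agree : ∀ {x} → x ∈ UVars R ρ (toℕ j) → σ x ≡ σ′ x
    agree x∈ with ∈ₚ.∈-++⁻ (Xs R ρ) x∈
    ... | inj₁ x∈X = varVec-⟨⟩*-injective (Xs R ρ) (Vecₚ.++-injectiveˡ _ _ X⟨⟩++E⟨⟩≡) x∈X
    ... | inj₂ x∈E = varVec-⟨⟩*-injective (Es R ρ (toℕ j)) (Vecₚ.++-injectiveʳ _ _ X⟨⟩++E⟨⟩≡) x∈E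

  mutual
    ↦-functional : ∀ {u t t′} → u ↦ t → u ↦ t′ → t ≡ t′
    ↦-functional (var↦ x)    (var↦ .x)     = refl
    ↦-functional (fun↦ f rs) (fun↦ .f rs′) = cong (fun f) (↦*-functional rs rs′)
    ↦-functional (var↦ x)    (U↦ _ _ () _)
    ↦-functional (fun↦ f rs) (U↦ _ _ e _) with fun-injectiveˡ e
    ... | ()
    ↦-functional (U↦ ρ j refl (ustate (matched θ refl σ↦θ _) _ _ _)) (U↦ _ _ e (ustate (matched θ′ refl σ′↦θ′ _) _ _ _))
      with UApp-injective e
    ... | refl , refl , _ , σ≗σ′ = ⟨⟩-cong (ℓ ρ) λ {x} x∈ℓ →
      let x∈ = ∈ₚ.∈-++⁺ˡ (∈ₚ.∈-deduplicate⁺ ℕₚ._≟_ x∈ℓ)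
      in ↦-functional (σ↦θ x∈) (subst (_↦ θ′ x) (sym (σ≗σ′ x∈)) (σ′↦θ′ x∈))

    ↦*-functional : ∀ {n} {us : Vec TermU n} {ts ts′} → us ↦* ts → us ↦* ts′ → ts ≡ ts′
    ↦*-functional []       []         = refl
    ↦*-functional (r ∷ rs) (r′ ∷ rs′) = cong₂ _∷_ (↦-functional r r′) (↦*-functional rs rs′)

  mutual
    emb-⟨⟩-↦ : ∀ (s : Term F) {σ θ} → (∀ {x} → x ∈ vars s → σ x ↦ θ x) → emb R s ⟨ σ ⟩ ↦ s ⟨ θ ⟩
    emb-⟨⟩-↦ (var x)    σ↦θ = σ↦θ (here refl)
    emb-⟨⟩-↦ (fun f ss) σ↦θ = fun↦ f (emb*-⟨⟩-↦ ss σ↦θ)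

    emb*-⟨⟩-↦ : ∀ {n} (ss : Vec (Term F) n) {σ θ} → (∀ {x} → x ∈ vars* ss → σ x ↦ θ x) →
                emb* R ss ⟨ σ ⟩* ↦* ss ⟨ θ ⟩*
    emb*-⟨⟩-↦ []       σ↦θ = []
    emb*-⟨⟩-↦ (s ∷ ss) σ↦θ = emb-⟨⟩-↦ s (σ↦θ ∘ ∈ₚ.∈-++⁺ˡ) ∷ emb*-⟨⟩-↦ ss (σ↦θ ∘ ∈ₚ.∈-++⁺ʳ (vars s))

  emb↦ : ∀ (t : Term F) → emb R t ↦ t
  emb↦ t = subst₂ _↦_ (⟨var⟩ (emb R t)) (⟨var⟩ t) (emb-⟨⟩-↦ t λ {x} _ → var↦ x)

  private
    mutual
      ↦-at-vars : ∀ (s : Term F) {σ u t} → u ↦ t → u ≡ emb R s ⟨ σ ⟩ → ∀ {x} → x ∈ vars s → ∃ (σ x ↦_)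
      ↦-at-vars (var y)    r refl (here refl) = _ , r
      ↦-at-vars (fun f ss) (fun↦ .f rs) refl x∈ = ↦*-at-vars ss rs x∈
      ↦-at-vars (fun f ss) (U↦ _ _ e _) refl x∈ with fun-injectiveˡ e
      ... | ()

      ↦*-at-vars : ∀ {n} (ss : Vec (Term F) n) {σ ts} → emb* R ss ⟨ σ ⟩* ↦* ts →
                   ∀ {x} → x ∈ vars* ss → ∃ (σ x ↦_)
      ↦*-at-vars (s ∷ ss) (r ∷ rs) x∈ with ∈ₚ.∈-++⁻ (vars s) x∈
      ... | inj₁ x∈s  = ↦-at-vars s r refl x∈s
      ... | inj₂ x∈ss = ↦*-at-vars ss rs x∈ss

  emb-⟨⟩-↦-match : ∀ (s : Term F) {σ u t} → u ↦ t → u ≡ emb R s ⟨ σ ⟩ →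
    ∃ λ θ → t ≡ s ⟨ θ ⟩ × (∀ {x} → x ∈ vars s → σ x ↦ θ x)
  emb-⟨⟩-↦-match s {σ} r u≡ = θ , ↦-functional r (subst (_↦ s ⟨ θ ⟩) (sym u≡) (emb-⟨⟩-↦ s σ↦θ)) , σ↦θ
    where
    θ : Subst F
    θ x with x ∈? vars s
    ... | yes x∈ = proj₁ (↦-at-vars s r u≡ x∈)
    ... | no  _  = var x
    σ↦θ : ∀ {x} → x ∈ vars s → σ x ↦ θ x
    σ↦θ {x} x∈ with x ∈? vars s
    ... | yes x∈′ = proj₂ (↦-at-vars s r u≡ x∈′)
    ... | no  x∉  = ⊥-elim (x∉ x∈)

module BackTranslationSteps (R : CTRS F) (dctrs : IsDCTRS R) where

  open BackTranslation R public
  private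
    module V = RuleVariables R dctrs
    TermU = Term (USig R)

    ℓ : Idx R → Term F
    ℓ ρ = lhs (rule R ρ)

    cs : Idx R → List (Term F × Term F)
    cs ρ = conds (rule R ρ)

  ↦-UState : ∀ {u t ρ j w σ} → u ↦ t → u ≡ UApp ρ j w σ → UState ρ j w σ t
  ↦-UState (var↦ x)    ()
  ↦-UState (fun↦ f rs) e with fun-injectiveˡ e
  ... | ()
  ↦-UState (U↦ ρ j refl (ustate (matched θ t≡ σ↦θ sat) t′ ev v↦)) e with UApp-injective e
  ... | refl , refl , refl , σ≗σ′ =
    ustate (matched θ t≡ (λ {x} x∈ → subst (_↦ θ x) (σ≗σ′ x∈) (σ↦θ x∈)) sat) t′ ev v↦

  Matched-lhs : ∀ ρ {u t σ} → u ↦ t → u ≡ emb R (ℓ ρ) ⟨ σ ⟩ → Matched ρ 0 σ t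
  Matched-lhs ρ r u≡ with emb-⟨⟩-↦-match (ℓ ρ) r u≡
  ... | θ , t≡ , σ↦θ = matched θ t≡ (σ↦θ ∘ V.UVars-zero ρ) []

  Matched-enter : ∀ ρ j {σ t} → Matched ρ (toℕ j) σ t → UState ρ j (emb R (condS R ρ j) ⟨ σ ⟩) σ t
  Matched-enter ρ j fr@(matched θ _ σ↦θ _) =
    ustate fr _ ε (emb-⟨⟩-↦ (condS R ρ j) (σ↦θ ∘ V.vars-condS⊆UVars ρ j))

  Matched-fire : ∀ ρ {σ t} → Matched ρ (length (cs ρ)) σ t →
    ∃ λ t′ → emb R (rhs (rule R ρ)) ⟨ σ ⟩ ↦ t′ × t ⟶⟨ R ⟩ t′
  Matched-fire ρ (matched θ refl σ↦θ sat) =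
    _ , emb-⟨⟩-↦ (rhs (rule R ρ)) (σ↦θ ∘ V.vars-rhs⊆UVars ρ) ,
    rule-⟶ R ρ θ (subst (Satisfies R θ) (Listₚ.take-all _ (cs ρ) ℕₚ.≤-refl) sat)

  -- Once the (j+1)-th condition has been evaluated to t_{j+1}, the matcher θ
  -- is extended by a matcher of t_{j+1}; the two agree on shared variables
  -- because their images are both read back from σ.
  Matched-suc : ∀ ρ j {σ t} → UState ρ j (emb R (condT R ρ j) ⟨ σ ⟩) σ t → Matched ρ (suc (toℕ j)) σ t
  Matched-suc ρ j {σ} (ustate (matched θ t≡ σ↦θ sat) t′ ev v↦)
    with emb-⟨⟩-↦-match (condT R ρ j) v↦ refl
  ... | θ′ , t′≡ , σ↦θ′ = matched θ″ (trans t≡ (⟨⟩-cong (ℓ ρ) (θ≗θ″ ∘ V.vars-lhs⊆UVars ρ (toℕ j))))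
                                  σ↦θ″ satisfied″
    where
    θ″ : Subst F
    θ″ x with x ∈? UVars R ρ (toℕ j)
    ... | yes _ = θ x
    ... | no  _ = θ′ x

    θ≗θ″ : ∀ {x} → x ∈ UVars R ρ (toℕ j) → θ x ≡ θ″ x
    θ≗θ″ {x} x∈ with x ∈? UVars R ρ (toℕ j)
    ... | yes _  = refl
    ... | no  x∉ = ⊥-elim (x∉ x∈)

    θ′≗θ″ : ∀ {x} → x ∈ vars (condT R ρ j) → θ′ x ≡ θ″ x
    θ′≗θ″ {x} x∈ with x ∈? UVars R ρ (toℕ j)
    ... | yes x∈U = ↦-functional (σ↦θ′ x∈) (σ↦θ x∈U)
    ... | no  _   = refl

    σ↦θ″ : ∀ {x} → x ∈ UVars R ρ (suc (toℕ j)) → σ x ↦ θ″ x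
    σ↦θ″ {x} x∈ with x ∈? UVars R ρ (toℕ j) | V.UVars-suc ρ j x∈
    ... | yes x∈U | _        = σ↦θ x∈U
    ... | no  x∉U | inj₁ x∈U = ⊥-elim (x∉U x∈U)
    ... | no  _   | inj₂ x∈t = σ↦θ′ x∈t

    satisfied″ : Satisfies R θ″ (take (suc (toℕ j)) (cs ρ))
    satisfied″ = subst (Satisfies R θ″) (sym (Listₚ.take-suc (cs ρ) j))
      (Allₚ.∷ʳ⁺ (Satisfies-cong R _ (θ≗θ″ ∘ V.varsCond-take⊆UVars ρ (toℕ j)) sat)
                (subst₂ (λ a b → a ⟶⟨ R ⟩* b)
                   (⟨⟩-cong (condS R ρ j) (θ≗θ″ ∘ V.vars-condS⊆UVars ρ j))
                   (trans t′≡ (⟨⟩-cong (condT R ρ j) θ′≗θ″)) ev))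

  infix 4 _⟶⁼_
  _⟶⁼_ : Term F → Term F → Set
  a ⟶⁼ b = a ≡ b ⊎ a ⟶⟨ R ⟩ b

  ⟶*-⟶⁼ : ∀ {a b c} → a ⟶⟨ R ⟩* b → b ⟶⁼ c → a ⟶⟨ R ⟩* c
  ⟶*-⟶⁼ ss (inj₁ refl) = ss
  ⟶*-⟶⁼ ss (inj₂ st)   = ss ◅◅ st ◅ ε

  ↦-root-step : ∀ {l r} → URule R l r → ∀ {u t σ} → u ↦ t → u ≡ l ⟨ σ ⟩ →
    ∃ λ t′ → r ⟨ σ ⟩ ↦ t′ × t ⟶⁼ t′
  ↦-root-step (uncond ρ cs≡[]) r u≡ =
    let t′ , r′ , st = Matched-fire ρ (castMatched (sym (cong length cs≡[])) (Matched-lhs ρ r u≡))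
    in t′ , r′ , inj₂ st
  ↦-root-step (first ρ j j≡0) r u≡ =
    _ , U↦ ρ j refl (Matched-enter ρ j (castMatched (sym j≡0) (Matched-lhs ρ r u≡))) , inj₁ refl
  ↦-root-step (middle ρ j j′ j′≡) r u≡ =
    _ , U↦ ρ j′ refl (Matched-enter ρ j′ (castMatched (sym j′≡) (Matched-suc ρ j (↦-UState r u≡)))) , inj₁ refl
  ↦-root-step (last ρ j j-last) r u≡ =
    let t′ , r′ , st = Matched-fire ρ (castMatched j-last (Matched-suc ρ j (↦-UState r u≡)))
    in t′ , r′ , inj₂ st

  mutual
    ↦-step : ∀ {u u′ t} → u ↦ t → UCSStep R u u′ → ∃ λ t′ → u′ ↦ t′ × t ⟶⁼ t′
    ↦-step r (root σ l→r) = ↦-root-step l→r r refl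
    ↦-step (fun↦ f {us} {ts} rs) (arg k _ st) with ↦-step (↦*-lookup rs k) st
    ... | tₖ′ , rₖ′ , tₖ⟶⁼tₖ′ = fun f (ts [ k ]≔ tₖ′) , fun↦ f (↦*-[]≔ rs k rₖ′) , lift tₖ⟶⁼tₖ′
      where
      lift : lookup ts k ⟶⁼ tₖ′ → fun f ts ⟶⁼ fun f (ts [ k ]≔ tₖ′)
      lift (inj₁ refl)     = inj₁ (cong (fun f) (sym (Vecₚ.[]≔-lookup ts k)))
      lift (inj₂ (i , st)) = inj₂ (i , arg k tt st)
    ↦-step (U↦ ρ j refl d) (arg Fin.zero _ st) = _ , U↦ ρ j refl (UState-step d st) , inj₁ refl
    ↦-step (U↦ ρ j refl d) (arg (Fin.suc k) () st)

    UState-step : ∀ {ρ j v v′ σ t} → UState ρ j v σ t → UCSStep R v v′ → UState ρ j v′ σ t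
    UState-step (ustate fr t′ ev v↦) st with ↦-step v↦ st
    ... | t″ , v′↦ , t′⟶⁼t″ = ustate fr t″ (⟶*-⟶⁼ ev t′⟶⁼t″) v′↦

module QuasiDecreasing⇒μTerminating (R : CTRS F) (dctrs : IsDCTRS R) (qd : QuasiDecreasing R) where

  open BackTranslationSteps R dctrs
  private
    TermU = Term (USig R)
    _⟶μ_ = UCSStep R

    ℓ : Idx R → Term F
    ℓ ρ = lhs (rule R ρ)

    cs : Idx R → List (Term F × Term F)
    cs ρ = conds (rule R ρ)

    _≻_ = proj₁ qd
    ≻-wellFounded = proj₁ (proj₂ qd)
    ≻-trans = proj₁ (proj₂ (proj₂ qd))
    ≻⊎▷⁺⇒≻ = proj₁ (proj₂ (proj₂ (proj₂ (proj₂ qd))))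
    ⟶⇒≻ = proj₁ (proj₂ (proj₂ (proj₂ (proj₂ (proj₂ qd)))))
    ≻-condition = proj₂ (proj₂ (proj₂ (proj₂ (proj₂ (proj₂ qd)))))

  SN : TermU → Set
  SN = Acc (flip _⟶μ_)

  ▷⇒≻ : ∀ {a b} → a ▷ b → a ≻ b
  ▷⇒≻ a▷b = ≻⊎▷⁺⇒≻ _ _ [ inj₂ a▷b ]

  ≻-⟶* : ∀ {a b c} → a ≻ b → b ⟶⟨ R ⟩* c → a ≻ c
  ≻-⟶* a≻b ε         = a≻b
  ≻-⟶* a≻b (st ◅ ss) = ≻-⟶* (≻-trans a≻b (⟶⇒≻ _ _ st)) ss

  SN-below : Term F → Set
  SN-below t = ∀ {t′} → t ≻ t′ → ∀ {u} → u ↦ t′ → SN u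

  UState-SN : ∀ {t} → SN-below t → ∀ {ρ j v σ} → UState ρ j v σ t → SN v
  UState-SN below {ρ} {j} (ustate (matched θ t≡ _ sat) t′ ev v↦) =
    below (≻-⟶* (subst (_≻ (condS R ρ j ⟨ θ ⟩)) (sym t≡)
                   (≻-condition ρ θ _ _ _ _ (split-at-index (cs ρ) j) sat)) ev) v↦

  var-irreducible : ∀ {u u′} → u ⟶μ u′ → ∀ {x} → u ≢ var x
  var-irreducible (root σ (uncond ρ _))  = emb-nonvar R (ℓ ρ) (proj₁ (dctrs ρ))
  var-irreducible (root σ (first ρ _ _)) = emb-nonvar R (ℓ ρ) (proj₁ (dctrs ρ))
  var-irreducible (root σ (middle _ _ _ _)) ()
  var-irreducible (root σ (last _ _ _))     ()
  var-irreducible (arg _ _ _)               ()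

  lhs-root-original : ∀ ρ {σ f us} → emb R (ℓ ρ) ⟨ σ ⟩ ≡ fun f us → ∃ λ g → f ≡ inj₁ g
  lhs-root-original ρ = emb-nonvar-root R (ℓ ρ) (proj₁ (dctrs ρ))

  -- m counts the conditions of ρ not yet entered; the middle rules decrease it.
  mutual
    UApp-SN : ∀ {t} → SN-below t → ∀ m ρ j {v σ} → toℕ j + m ≡ length (cs ρ) →
              UState ρ j v σ t → SN v → SN (UApp ρ j v σ)
    UApp-SN below m ρ j j+m≡ d acc-v = acc (UApp-step below m ρ j j+m≡ d acc-v refl)

    UApp-step : ∀ {t} → SN-below t → ∀ m ρ j {v σ} → toℕ j + m ≡ length (cs ρ) →
                UState ρ j v σ t → SN v → ∀ {u u′} → u ≡ UApp ρ j v σ → u ⟶μ u′ → SN u′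
    UApp-step below m ρ j j+m≡ d _ u≡ (root σ′ l→r) = UApp-root-step below m ρ j j+m≡ d (sym u≡) l→r
    UApp-step below m ρ j j+m≡ d (acc rec) refl (arg Fin.zero _ st) =
      UApp-SN below m ρ j j+m≡ (UState-step d st) (rec st)
    UApp-step below m ρ j j+m≡ d _ refl (arg (Fin.suc k) () _)

    UApp-root-step : ∀ {t} → SN-below t → ∀ m ρ j {v σ} → toℕ j + m ≡ length (cs ρ) →
                     UState ρ j v σ t → ∀ {l r σ′} → UApp ρ j v σ ≡ l ⟨ σ′ ⟩ → URule R l r → SN (r ⟨ σ′ ⟩)
    UApp-root-step below m ρ j j+m≡ d u≡ (uncond ρ′ _) with lhs-root-original ρ′ (sym u≡)
    ... | _ , ()
    UApp-root-step below m ρ j j+m≡ d u≡ (first ρ′ _ _) with lhs-root-original ρ′ (sym u≡)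
    ... | _ , ()
    UApp-root-step below m ρ j j+m≡ d u≡ (last ρ′ j₀ j₀-last)
      with Matched-fire ρ′ (castMatched j₀-last (Matched-suc ρ′ j₀ (↦-UState (U↦ ρ j refl d) u≡)))
    ... | t′ , r′ , st = below (⟶⇒≻ _ _ st) r′
    UApp-root-step below m ρ j j+m≡ d u≡ (middle ρ′ j₀ j₁ j₁≡) with UApp-injective u≡
    ... | refl , refl , _ = UApp-middle-SN below m ρ j j+m≡ j₁ j₁≡ d′
      where
      d′ = Matched-enter ρ j₁ (castMatched (sym j₁≡) (Matched-suc ρ j (↦-UState (U↦ ρ j refl d) u≡)))

    UApp-middle-SN : ∀ {t} → SN-below t → ∀ m ρ j → toℕ j + m ≡ length (cs ρ) → ∀ j₁ → toℕ j₁ ≡ suc (toℕ j) →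
                     ∀ {w σ} → UState ρ j₁ w σ t → SN (UApp ρ j₁ w σ)
    UApp-middle-SN below zero ρ j j+0≡ j₁ j₁≡ d =
      ⊥-elim (ℕₚ.<-irrefl (trans (sym (ℕₚ.+-identityʳ _)) j+0≡)
        (ℕₚ.<-trans (ℕₚ.n<1+n (toℕ j)) (subst (_< length (cs ρ)) j₁≡ (Finₚ.toℕ<n j₁))))
    UApp-middle-SN below (suc m) ρ j j+m≡ j₁ j₁≡ d =
      UApp-SN below m ρ j₁ (trans (cong (_+ m) j₁≡) (trans (sym (ℕₚ.+-suc (toℕ j) m)) j+m≡)) d (UState-SN below d)

  mutual
    fun-SN : ∀ f {us ts} → SN-below (fun f ts) → us ↦* ts → Acc (flip (UpdateAt _⟶μ_)) us → SN (fun (inj₁ f) us)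
    fun-SN f below rs acc-us = acc (fun-step f below rs acc-us refl)

    fun-step : ∀ f {us ts} → SN-below (fun f ts) → us ↦* ts → Acc (flip (UpdateAt _⟶μ_)) us →
               ∀ {u u′} → u ≡ fun (inj₁ f) us → u ⟶μ u′ → SN u′
    fun-step f below rs _ u≡ (root σ′ l→r) = fun-root-step f below rs (sym u≡) l→r
    fun-step f {ts = ts} below rs (acc rec) refl (arg k _ st) with ↦-step (↦*-lookup rs k) st
    ... | _ , rₖ′ , inj₁ refl =
      fun-SN f below (subst (_ ↦*_) (Vecₚ.[]≔-lookup ts k) (↦*-[]≔ rs k rₖ′)) (rec (k , _ , st , refl))
    ... | _ , rₖ′ , inj₂ (i , stₖ) = below (⟶⇒≻ _ _ (i , arg k tt stₖ)) (fun↦ f (↦*-[]≔ rs k rₖ′))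

    fun-root-step : ∀ f {us ts} → SN-below (fun f ts) → us ↦* ts →
                    ∀ {l r σ′} → fun (inj₁ f) us ≡ l ⟨ σ′ ⟩ → URule R l r → SN (r ⟨ σ′ ⟩)
    fun-root-step f below rs u≡ (uncond ρ cs≡[])
      with Matched-fire ρ (castMatched (sym (cong length cs≡[])) (Matched-lhs ρ (fun↦ f rs) u≡))
    ... | t′ , r′ , st = below (⟶⇒≻ _ _ st) r′
    fun-root-step f below rs u≡ (first ρ j j≡0) =
      UApp-SN below (length (cs ρ)) ρ j (cong (_+ length (cs ρ)) j≡0) d (UState-SN below d)
      where d = Matched-enter ρ j (castMatched (sym j≡0) (Matched-lhs ρ (fun↦ f rs) u≡))
    fun-root-step f below rs u≡ (middle _ _ _ _) with fun-injectiveˡ u≡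
    ... | ()
    fun-root-step f below rs u≡ (last _ _ _) with fun-injectiveˡ u≡
    ... | ()

  ↦-SN-step : ∀ {t} → SN-below t → ∀ {u} → u ↦ t → SN u
  ↦-SN-step below (var↦ x)         = acc λ st → ⊥-elim (var-irreducible st refl)
  ↦-SN-step below (fun↦ f {us} rs) =
    fun-SN f below rs (UpdateAt-acc _⟶μ_ us λ k → below (▷⇒≻ (imm k)) (↦*-lookup rs k))
  ↦-SN-step below (U↦ ρ j refl d)  =
    UApp-SN below (length (cs ρ) ∸ toℕ j) ρ j (ℕₚ.m+[n∸m]≡n (ℕₚ.<⇒≤ (Finₚ.toℕ<n j))) d (UState-SN below d)

  ↦-SN : ∀ t → Acc (flip _≻_) t → ∀ {u} → u ↦ t → SN u
  ↦-SN t (acc rec) = ↦-SN-step (λ t≻t′ → ↦-SN _ (rec t≻t′))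

  μTerminating : UCS-μTerminatingOnOriginal R
  μTerminating t = ↦-SN t (≻-wellFounded t) (emb↦ t)

corollary7 : ∀ (F : Sig) (R : CTRS F) → IsDCTRS R →
    (QuasiDecreasing R ⇔ UCS-μTerminatingOnOriginal R)
corollary7 F R dctrs = mk⇔ (QuasiDecreasing⇒μTerminating.μTerminating R dctrs)
                           (μTerminating⇒QuasiDecreasing.quasiDecreasing R)
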